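{- Let $a,b\in\mathbb{C}$ and let $n\geq 1$ be an integer. Then $$C_n^{(a,b)}= a\, M_{n-1}^{(a+b,\,ab)},\qquad b\, S_n^{(a,b)}= (a+b)\, C_n^{(b,\,a+b)},\qquad S_{n}^{(a,b)}= (a+b)\, M_{n-1}^{(a+2b,\,ab+b^2)}.$$
   Context: A Catalan path of order $n$ is a word $p_1p_2\cdots p_{2n}$ in the letters $\mathbf{N}=(0,1)$ and $\mathbf{E}=(1,0)$ with exactly $n$ of each letter such that every prefix contains at least as many $\mathbf{N}$'s as $\mathbf{E}$'s (i.e. a lattice path from $(0,0)$ to $(n,n)$ never going below $y=x$). A valley of such a path is an index $i$ with $p_i=\mathbf{E}$ and $p_{i+1}=\mathbf{N}$; let $\mathrm{valley}(P)$ be the number of valleys. The valley-type $(a,b)$-Catalan number is $C_n^{(a,b)}=\sum_P a^{\,n-\mathrm{valley}(P)}b^{\,\mathrm{valley}(P)}$ over all Catalan paths $P$ of order $n$ (i.e. each $\mathbf{E}$ step immediately followed by an $\mathbf{N}$ step gets weight $b$, every other $\mathbf{E}$ step weight $a$); equivalently $C_n^{(a,b)}=\sum_{k=0}^{n-1}\frac1n\binom{n}{k}\binom{n}{k+1}a^{n-k}b^k$. A Schröder path of order $n$ is a lattice path from $(0,0)$ to $(n,n)$ with steps $\mathbf{N}=(0,1)$, $\mathbf{E}=(1,0)$, $\mathbf{D}=(1,1)$ never going below $y=x$; $S_n^{(a,b)}=\sum_P a^{\#\mathbf{D}(P)}b^{\#\mathbf{E}(P)}$ over all Schröder paths of order $n$.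 A Motzkin path of order $m\geq 0$ is a lattice path from $(0,0)$ to $(m,m)$ with steps $\mathbf{D}=(1,1)$, $\mathbf{N}_2=(0,2)$, $\mathbf{E}_2=(2,0)$ never going below $y=x$ (empty path for $m=0$); $M_m^{(a,b)}=\sum_P a^{\#\mathbf{D}(P)}b^{\#\mathbf{E}_2(P)}$ over all Motzkin paths of order $m$. -}

module Defs where

open import Level using (Level)
open import Data.Nat using (ℕ; zero; suc; _∸_)
open import Data.Bool using (Bool; true; false; _∧_; if_then_else_)
open import Data.List using (List; []; _∷_; _++_; map; concatMap; filter; foldr; upTo)
open import Data.Nat using (_≡ᵇ_)
open import Algebra.Bundles using (CommutativeRing)

words : {A : Set} → List A → ℕ → List (List A)
words al zero    = [] ∷ []
words al (suc k) = concatMap (λ x → map (x ∷_) (words al k)) al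

wordsUpTo : {A : Set} → List A → ℕ → List (List A)
wordsUpTo al k = concatMap (words al) (upTo (suc k))

-- Heights: we track h = y - x along the path; a step that would make
-- h negative means the path goes below y = x.

-- Catalan paths: letters N = (0,1), E = (1,0)
data CStep : Set where
  N E : CStep

cAlphabet : List CStep
cAlphabet = N ∷ E ∷ []

cValidFrom : ℕ → List CStep → Bool
cValidFrom h       []      = h ≡ᵇ 0
cValidFrom h       (N ∷ w) = cValidFrom (suc h) w
cValidFrom zero    (E ∷ w) = false
cValidFrom (suc h) (E ∷ w) = cValidFrom h w

-- Catalan paths of order n: words of length 2n in N,E with n of each
-- (forced by length 2n and final height 0), never below y = x.
catalanPaths : ℕ → List (List CStep)
catalanPaths n = filter (λ w → Data.Bool.T? (cValidFrom 0 w)) (words cAlphabet (n Data.Nat.+ n))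

valley : List CStep → ℕ
valley []           = 0
valley (E ∷ N ∷ w)  = suc (valley (N ∷ w))
valley (_ ∷ w)      = valley w

-- Schröder paths: N = (0,1), E = (1,0), D = (1,1)
data SStep : Set where
  N E D : SStep

sAlphabet : List SStep
sAlphabet = N ∷ E ∷ D ∷ []

sValidFrom : ℕ → List SStep → Bool
sValidFrom h       []      = h ≡ᵇ 0
sValidFrom h       (N ∷ w) = sValidFrom (suc h) w
sValidFrom zero    (E ∷ w) = false
sValidFrom (suc h) (E ∷ w) = sValidFrom h w
sValidFrom h       (D ∷ w) = sValidFrom h w

sWidth : List SStep → ℕ
sWidth []      = 0
sWidth (N ∷ w) = sWidth w
sWidth (E ∷ w) = suc (sWidth w)
sWidth (D ∷ w) = suc (sWidth w)

numD : List SStep → ℕ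
numD []      = 0
numD (D ∷ w) = suc (numD w)
numD (_ ∷ w) = numD w

numE : List SStep → ℕ
numE []      = 0
numE (E ∷ w) = suc (numE w)
numE (_ ∷ w) = numE w

-- Schröder paths of order n: every such path has at most 2n steps;
-- we enumerate all words of length ≤ 2n (each exactly once) and keep
-- those ending at (n,n) (final height 0, width n) never below y = x.
schroderPaths : ℕ → List (List SStep)
schroderPaths n =
  filter (λ w → Data.Bool.T? (sValidFrom 0 w ∧ (sWidth w ≡ᵇ n)))
         (wordsUpTo sAlphabet (n Data.Nat.+ n))

-- Motzkin paths: D = (1,1), N₂ = (0,2), E₂ = (2,0)
data MStep : Set where
  D N₂ E₂ : MStep

mAlphabet : List MStep
mAlphabet = D ∷ N₂ ∷ E₂ ∷ []

mValidFrom : ℕ → List MStep → Bool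
mValidFrom h             []       = h ≡ᵇ 0
mValidFrom h             (D ∷ w)  = mValidFrom h w
mValidFrom h             (N₂ ∷ w) = mValidFrom (suc (suc h)) w
mValidFrom (suc (suc h)) (E₂ ∷ w) = mValidFrom h w
mValidFrom _             (E₂ ∷ w) = false

mNumD : List MStep → ℕ
mNumD []      = 0
mNumD (D ∷ w) = suc (mNumD w)
mNumD (_ ∷ w) = mNumD w

mNumE₂ : List MStep → ℕ
mNumE₂ []       = 0
mNumE₂ (E₂ ∷ w) = suc (mNumE₂ w)
mNumE₂ (_ ∷ w)  = mNumE₂ w

-- Motzkin paths of order m: each step raises x+y by 2, so such a path
-- has exactly m steps; keep those ending on the diagonal, never below it.
motzkinPaths : ℕ → List (List MStep)
motzkinPaths m = filter (λ w → Data.Bool.T? (mValidFrom 0 w)) (words mAlphabet m)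

module Weights {c ℓ : Level} (R : CommutativeRing c ℓ) where
  open CommutativeRing R

  pow : Carrier → ℕ → Carrier
  pow x zero    = 1#
  pow x (suc k) = x * pow x k

  sumOver : {A : Set} → (A → Carrier) → List A → Carrier
  sumOver f = foldr (λ x acc → f x + acc) 0#

  Cat : Carrier → Carrier → ℕ → Carrier
  Cat a b n = sumOver (λ P → pow a (n ∸ valley P) * pow b (valley P)) (catalanPaths n)

  Sch : Carrier → Carrier → ℕ → Carrier
  Sch a b n = sumOver (λ P → pow a (numD P) * pow b (numE P)) (schroderPaths n)

  Mot : Carrier → Carrier → ℕ → Carrier
  Mot a b m = sumOver (λ P → pow a (mNumD P) * pow b (mNumE₂ P)) (motzkinPaths m)

-- Count each family of paths by the height h above the diagonal at which they start.
-- Cutting a path that starts at height h + 1 (h + 2 for Motzkin paths) at its first visit to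
-- height h turns its count into a Cauchy product of the counts from heights 0 and h.  At height 0
-- this yields the Motzkin recurrence M(m+1) = A M(m) + B Σ M(i) M(m-1-i), and for Catalan and
-- Schröder paths, sampled at even lengths (odd ones vanish by parity), quadratic recurrences whose
-- solutions are a·M and (a+b)·M for the stated parameters.  The middle identity is the third
-- combined with the first at parameters (b, a + b).

module Submission where

open import Defs
open import Level using (Level)
open import Data.Nat as ℕ using (ℕ; _≤_; _∸_; zero; suc; _<_; _≡ᵇ_; s≤s; z≤n; parity; ⌊_/2⌋)
open import Data.Product using (_×_; _,_; proj₁; proj₂)
open import Algebra.Bundles using (CommutativeRing)

open import Data.Bool using (Bool; true; false; if_then_else_; _∧_; T; T?)
open import Data.Bool.Properties using (∧-identityʳ)
open import Data.Empty using (⊥-elim)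
open import Data.List using (List; []; _∷_; _++_; map; concatMap; filter; length; upTo)
open import Data.List.Properties using (map-upTo; upTo-∷ʳ)
open import Data.Nat.Induction using (<-rec)
import Data.Nat.Properties as ℕₚ
open ℕₚ using (≤-refl; ≤-trans; ≤-reflexive; <⇒≱; m≤n⇒m≤1+n; +-suc; +-∸-assoc; ≡ᵇ⇒≡; n≡⌊n+n/2⌋)
open import Data.Parity.Base using (1ℙ)
open import Relation.Binary.PropositionalEquality as ≡ using (_≡_)

parity-odd : ∀ i → parity (suc (i ℕ.+ i)) ≡ 1ℙ
parity-odd zero    = ≡.refl
parity-odd (suc i) = ≡.trans (≡.cong parity (+-suc i i)) (parity-odd i)

double-suc : ∀ i → suc i ℕ.+ suc i ≡ suc (suc (i ℕ.+ i))
double-suc i = ≡.cong suc (+-suc i i)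

parity-suc-+-suc : ∀ h t → parity (suc h ℕ.+ suc t) ≡ parity (h ℕ.+ t)
parity-suc-+-suc h t = ≡.cong (λ n → parity (suc n)) (+-suc h t)

parity-+-2 : ∀ h t → parity (h ℕ.+ suc (suc t)) ≡ parity (h ℕ.+ t)
parity-+-2 h t = ≡.cong parity (≡.trans (+-suc h (suc t)) (≡.cong suc (+-suc h t)))

m≤n⇒m<2+n : ∀ {m n} → m ≤ n → m < suc (suc n)
m≤n⇒m<2+n m≤n = s≤s (m≤n⇒m≤1+n m≤n)

double-≡ᵇ : ∀ m n → (m ℕ.+ m ≡ᵇ n ℕ.+ n) ≡ (m ≡ᵇ n)
double-≡ᵇ zero    zero    = ≡.refl
double-≡ᵇ zero    (suc n) = ≡.refl
double-≡ᵇ (suc m) zero    = ≡.refl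
double-≡ᵇ (suc m) (suc n) = ≡.trans (≡.cong₂ _≡ᵇ_ (+-suc m m) (+-suc n n)) (double-≡ᵇ m n)

module ListSums {c ℓ} (R : CommutativeRing c ℓ) where
  open CommutativeRing R
  open Weights R
  open import Algebra.Properties.CommutativeSemigroup +-commutativeSemigroup using (interchange)
  open import Relation.Binary.Reasoning.Setoid setoid

  sumOver-cong : ∀ {A : Set} {f g : A → Carrier} → (∀ x → f x ≈ g x) → ∀ xs → sumOver f xs ≈ sumOver g xs
  sumOver-cong f≈g []       = refl
  sumOver-cong f≈g (x ∷ xs) = +-cong (f≈g x) (sumOver-cong f≈g xs)

  sumOver-++ : ∀ {A : Set} (f : A → Carrier) xs ys → sumOver f (xs ++ ys) ≈ sumOver f xs + sumOver f ys
  sumOver-++ f []       ys = sym (+-identityˡ _)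
  sumOver-++ f (x ∷ xs) ys = trans (+-congˡ (sumOver-++ f xs ys)) (sym (+-assoc _ _ _))

  sumOver-map : ∀ {A B : Set} (f : B → Carrier) (g : A → B) xs → sumOver f (map g xs) ≈ sumOver (λ x → f (g x)) xs
  sumOver-map f g []       = refl
  sumOver-map f g (x ∷ xs) = +-congˡ (sumOver-map f g xs)

  sumOver-concatMap : ∀ {A B : Set} (f : B → Carrier) (g : A → List B) xs →
                      sumOver f (concatMap g xs) ≈ sumOver (λ x → sumOver f (g x)) xs
  sumOver-concatMap f g []       = refl
  sumOver-concatMap f g (x ∷ xs) = trans (sumOver-++ f (g x) _) (+-congˡ (sumOver-concatMap f g xs))

  sumOver-filter : ∀ {A : Set} (P : A → Bool) (f : A → Carrier) xs →
                   sumOver f (filter (λ x → T? (P x)) xs) ≈ sumOver (λ x → if P x then f x else 0#) xs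
  sumOver-filter P f [] = refl
  sumOver-filter P f (x ∷ xs) with P x
  ... | true  = +-congˡ (sumOver-filter P f xs)
  ... | false = trans (sumOver-filter P f xs) (sym (+-identityˡ _))

  sumOver-+ : ∀ {A : Set} (f g : A → Carrier) xs → sumOver (λ x → f x + g x) xs ≈ sumOver f xs + sumOver g xs
  sumOver-+ f g []       = sym (+-identityˡ _)
  sumOver-+ f g (x ∷ xs) = trans (+-congˡ (sumOver-+ f g xs)) (interchange _ _ _ _)

  sumOver-upTo-suc : ∀ (f : ℕ → Carrier) n → sumOver f (upTo (suc n)) ≈ f 0 + sumOver (λ i → f (suc i)) (upTo n)
  sumOver-upTo-suc f n = +-congˡ (trans (reflexive (≡.cong (sumOver f) (≡.sym (map-upTo suc n))))
                                        (sumOver-map f suc (upTo n)))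

  sumOver-upTo-last : ∀ (f : ℕ → Carrier) n → sumOver f (upTo (suc n)) ≈ sumOver f (upTo n) + f n
  sumOver-upTo-last f n = begin
    sumOver f (upTo (suc n))           ≡⟨ ≡.cong (sumOver f) (upTo-∷ʳ n) ⟨
    sumOver f (upTo n ++ n ∷ [])       ≈⟨ sumOver-++ f (upTo n) (n ∷ []) ⟩
    sumOver f (upTo n) + (f n + 0#)    ≈⟨ +-congˡ (+-identityʳ _) ⟩
    sumOver f (upTo n) + f n           ∎

  sumOver-zero : ∀ {A : Set} (xs : List A) → sumOver (λ _ → 0#) xs ≈ 0#
  sumOver-zero []       = refl
  sumOver-zero (x ∷ xs) = trans (+-identityˡ _) (sumOver-zero xs)

  sumOver-*ˡ : ∀ {A : Set} (k : Carrier) (f : A → Carrier) xs → sumOver (λ x → k * f x) xs ≈ k * sumOver f xs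
  sumOver-*ˡ k f []       = sym (zeroʳ k)
  sumOver-*ˡ k f (x ∷ xs) = trans (+-congˡ (sumOver-*ˡ k f xs)) (sym (distribˡ k _ _))

  if-cong : ∀ (b : Bool) {x y} → x ≈ y → (if b then x else 0#) ≈ (if b then y else 0#)
  if-cong true  x≈y = x≈y
  if-cong false x≈y = refl

  sumOver-if-*ˡ : ∀ {A : Set} (P : A → Bool) k (f : A → Carrier) xs →
                  sumOver (λ x → if P x then k * f x else 0#) xs ≈ k * sumOver (λ x → if P x then f x else 0#) xs
  sumOver-if-*ˡ P k f xs = trans (sumOver-cong (λ x → if-*ˡ (P x)) xs) (sumOver-*ˡ k _ xs)
    where
    if-*ˡ : ∀ b {x} → (if b then k * x else 0#) ≈ k * (if b then x else 0#)
    if-*ˡ true  = refl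
    if-*ˡ false = sym (zeroʳ k)

  sumOver-words-suc : ∀ {A : Set} (al : List A) (f : List A → Carrier) k →
                      sumOver f (words al (suc k)) ≈ sumOver (λ x → sumOver (λ w → f (x ∷ w)) (words al k)) al
  sumOver-words-suc al f k =
    trans (sumOver-concatMap f (λ x → map (x ∷_) (words al k)) al)
          (sumOver-cong (λ x → sumOver-map f (x ∷_) (words al k)) al)

  sumOver-words-cong : ∀ {A : Set} (al : List A) k {f g : List A → Carrier} →
                       (∀ w → length w ≡ k → f w ≈ g w) → sumOver f (words al k) ≈ sumOver g (words al k)
  sumOver-words-cong al zero    f≈g = +-congʳ (f≈g [] ≡.refl)
  sumOver-words-cong al (suc k) {f} {g} f≈g =
    trans (sumOver-words-suc al f k)
      (trans (sumOver-cong (λ x → sumOver-words-cong al k (λ w p → f≈g (x ∷ w) (≡.cong suc p))) al)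
             (sym (sumOver-words-suc al g k)))

module CauchyProduct {c ℓ} (R : CommutativeRing c ℓ) where
  open CommutativeRing R
  open import Relation.Binary.Reasoning.Setoid setoid
  open import Algebra.Properties.CommutativeSemigroup +-commutativeSemigroup using (interchange)

  tail : (ℕ → Carrier) → ℕ → Carrier
  tail f i = f (suc i)

  shift : (ℕ → Carrier) → ℕ → Carrier
  shift f zero    = 0#
  shift f (suc i) = f i

  infixl 7 _⋆_
  _⋆_ : (ℕ → Carrier) → (ℕ → Carrier) → ℕ → Carrier
  (f ⋆ g) zero    = f 0 * g 0
  (f ⋆ g) (suc n) = f 0 * g (suc n) + (tail f ⋆ g) n

  shift-cong : ∀ {f g} → (∀ i → f i ≈ g i) → ∀ n → shift f n ≈ shift g n
  shift-cong f≈g zero    = refl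
  shift-cong f≈g (suc n) = f≈g n

  ⋆-cong-≤ : ∀ n {f f′ g g′} → (∀ i → i ≤ n → f i ≈ f′ i) → (∀ i → i ≤ n → g i ≈ g′ i) →
             (f ⋆ g) n ≈ (f′ ⋆ g′) n
  ⋆-cong-≤ zero    f≈ g≈ = *-cong (f≈ 0 z≤n) (g≈ 0 z≤n)
  ⋆-cong-≤ (suc n) f≈ g≈ =
    +-cong (*-cong (f≈ 0 z≤n) (g≈ (suc n) ≤-refl))
           (⋆-cong-≤ n (λ i i≤n → f≈ (suc i) (s≤s i≤n)) (λ i i≤n → g≈ i (m≤n⇒m≤1+n i≤n)))

  ⋆-cong : ∀ n {f f′ g g′} → (∀ i → f i ≈ f′ i) → (∀ i → g i ≈ g′ i) → (f ⋆ g) n ≈ (f′ ⋆ g′) n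
  ⋆-cong n f≈ g≈ = ⋆-cong-≤ n (λ i _ → f≈ i) (λ i _ → g≈ i)

  ⋆-unfoldˡ : ∀ f g n → (f ⋆ g) n ≈ f 0 * g n + shift (tail f ⋆ g) n
  ⋆-unfoldˡ f g zero    = sym (+-identityʳ _)
  ⋆-unfoldˡ f g (suc n) = refl

  ⋆-suc-last : ∀ f g n → (f ⋆ g) (suc n) ≈ (f ⋆ tail g) n + f (suc n) * g 0
  ⋆-suc-last f g zero    = refl
  ⋆-suc-last f g (suc n) = trans (+-congˡ (⋆-suc-last (tail f) g n)) (sym (+-assoc _ _ _))

  ⋆-comm : ∀ f g n → (f ⋆ g) n ≈ (g ⋆ f) n
  ⋆-comm f g zero    = *-comm _ _
  ⋆-comm f g (suc n) =
    trans (+-congˡ (⋆-comm (tail f) g n))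
      (trans (+-comm _ _) (trans (+-congˡ (*-comm _ _)) (sym (⋆-suc-last g f n))))

  ⋆-unfoldʳ : ∀ f g n → (f ⋆ g) n ≈ f n * g 0 + shift (f ⋆ tail g) n
  ⋆-unfoldʳ f g zero    = sym (+-identityʳ _)
  ⋆-unfoldʳ f g (suc n) = trans (⋆-suc-last f g n) (+-comm _ _)

  ⋆-distribʳ : ∀ f f′ g n → ((λ i → f i + f′ i) ⋆ g) n ≈ (f ⋆ g) n + (f′ ⋆ g) n
  ⋆-distribʳ f f′ g zero    = distribʳ _ _ _
  ⋆-distribʳ f f′ g (suc n) =
    trans (+-cong (distribʳ _ _ _) (⋆-distribʳ (tail f) (tail f′) g n)) (interchange _ _ _ _)

  ⋆-*ˡ : ∀ k f g n → ((λ i → k * f i) ⋆ g) n ≈ k * (f ⋆ g) n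
  ⋆-*ˡ k f g zero    = *-assoc _ _ _
  ⋆-*ˡ k f g (suc n) = trans (+-cong (*-assoc _ _ _) (⋆-*ˡ k (tail f) g n)) (sym (distribˡ _ _ _))

  ⋆-*ʳ : ∀ k f g n → (f ⋆ (λ i → k * g i)) n ≈ k * (f ⋆ g) n
  ⋆-*ʳ k f g n = trans (⋆-comm f _ n) (trans (⋆-*ˡ k g f n) (*-congˡ (⋆-comm g f n)))

  ⋆-shiftˡ : ∀ f g n → (shift f ⋆ g) n ≈ shift (f ⋆ g) n
  ⋆-shiftˡ f g zero    = zeroˡ _
  ⋆-shiftˡ f g (suc n) = trans (+-congʳ (zeroˡ _)) (+-identityˡ _)

  ⋆-shiftʳ : ∀ f g n → (f ⋆ shift g) n ≈ shift (f ⋆ g) n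
  ⋆-shiftʳ f g n = trans (⋆-comm f _ n) (trans (⋆-shiftˡ g f n) (shift-cong (⋆-comm g f) n))

  ⋆-assoc : ∀ f g h n → ((f ⋆ g) ⋆ h) n ≈ (f ⋆ (g ⋆ h)) n
  ⋆-assoc f g h zero    = *-assoc _ _ _
  ⋆-assoc f g h (suc n) = begin
      ((f ⋆ g) ⋆ h) (suc n)
    ≈⟨ ⋆-cong (suc n) (⋆-unfoldˡ f g) (λ _ → refl) ⟩
      ((λ i → f 0 * g i + shift (tail f ⋆ g) i) ⋆ h) (suc n)
    ≈⟨ ⋆-distribʳ (λ i → f 0 * g i) (shift (tail f ⋆ g)) h (suc n) ⟩
      ((λ i → f 0 * g i) ⋆ h) (suc n) + (shift (tail f ⋆ g) ⋆ h) (suc n)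
    ≈⟨ +-cong (⋆-*ˡ (f 0) g h (suc n)) (⋆-shiftˡ _ h (suc n)) ⟩
      f 0 * (g ⋆ h) (suc n) + ((tail f ⋆ g) ⋆ h) n
    ≈⟨ +-congˡ (⋆-assoc (tail f) g h n) ⟩
      (f ⋆ (g ⋆ h)) (suc n) ∎

  ⋆-shift-assoc : ∀ f g h n → (shift (f ⋆ g) ⋆ h) n ≈ (f ⋆ shift (g ⋆ h)) n
  ⋆-shift-assoc f g h n =
    trans (⋆-shiftˡ _ h n) (trans (shift-cong (⋆-assoc f g h) n) (sym (⋆-shiftʳ f _ n)))

  ⋆-even : ∀ f g → (∀ i → f (suc (i ℕ.+ i)) ≈ 0#) →
           ∀ n → (f ⋆ g) (n ℕ.+ n) ≈ ((λ i → f (i ℕ.+ i)) ⋆ (λ i → g (i ℕ.+ i))) n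
  ⋆-even f g f-odd zero    = refl
  ⋆-even f g f-odd (suc n) = begin
      (f ⋆ g) (suc n ℕ.+ suc n)
    ≡⟨ ≡.cong (f ⋆ g) (double-suc n) ⟩
      f 0 * g (suc (suc (n ℕ.+ n))) + (f 1 * g (suc (n ℕ.+ n)) + (tail (tail f) ⋆ g) (n ℕ.+ n))
    ≈⟨ +-congˡ (trans (+-congʳ (trans (*-congʳ (f-odd 0)) (zeroˡ _))) (+-identityˡ _)) ⟩
      f 0 * g (suc (suc (n ℕ.+ n))) + (tail (tail f) ⋆ g) (n ℕ.+ n)
    ≈⟨ +-congˡ (⋆-even (tail (tail f)) g tail²-odd n) ⟩
      f 0 * g (suc (suc (n ℕ.+ n))) + ((λ i → f (suc (suc (i ℕ.+ i)))) ⋆ (λ i → g (i ℕ.+ i))) n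
    ≈⟨ +-cong (*-congˡ (reflexive (≡.cong g (≡.sym (double-suc n)))))
              (⋆-cong n (λ i → reflexive (≡.cong f (≡.sym (double-suc i)))) (λ _ → refl)) ⟩
      ((λ i → f (i ℕ.+ i)) ⋆ (λ i → g (i ℕ.+ i))) (suc n) ∎
    where
    tail²-odd : ∀ i → f (suc (suc (suc (i ℕ.+ i)))) ≈ 0#
    tail²-odd i = trans (reflexive (≡.cong (λ j → f (suc j)) (≡.sym (double-suc i)))) (f-odd (suc i))

  ⋆-reassoc-≤ : ∀ k f g h {F H} n → (∀ i → i ≤ n → F i ≈ k * shift (f ⋆ g) i) →
                (∀ i → i ≤ n → H i ≈ k * shift (g ⋆ h) i) → (F ⋆ h) n ≈ (f ⋆ H) n
  ⋆-reassoc-≤ k f g h n F≈ H≈ = begin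
      (_ ⋆ h) n                       ≈⟨ ⋆-cong-≤ n F≈ (λ _ _ → refl) ⟩
      ((λ i → k * shift (f ⋆ g) i) ⋆ h) n ≈⟨ ⋆-*ˡ k _ h n ⟩
      k * (shift (f ⋆ g) ⋆ h) n          ≈⟨ *-congˡ (⋆-shift-assoc f g h n) ⟩
      k * (f ⋆ shift (g ⋆ h)) n          ≈⟨ ⋆-*ʳ k f _ n ⟨
      (f ⋆ (λ i → k * shift (g ⋆ h) i)) n ≈⟨ ⋆-cong-≤ n (λ _ _ → refl) (λ i i≤n → sym (H≈ i i≤n)) ⟩
      (f ⋆ _) n                       ∎

  shift-⋆-*ʳ : ∀ k f g h n → (∀ i → i < n → h i ≈ k * g i) → shift (f ⋆ h) n ≈ k * shift (f ⋆ g) n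
  shift-⋆-*ʳ k f g h zero    h≈ = sym (zeroʳ k)
  shift-⋆-*ʳ k f g h (suc n) h≈ =
    trans (⋆-cong-≤ n (λ _ _ → refl) (λ i i≤n → h≈ i (s≤s i≤n))) (⋆-*ʳ k f g n)

module Recurrences {c ℓ} (R : CommutativeRing c ℓ) where
  open CommutativeRing R
  open CauchyProduct R
  open import Relation.Binary.Reasoning.Setoid setoid
  open import Algebra.Solver.Ring.NaturalCoefficients.Default commutativeSemiring using (solve; _:=_; _:+_; _:*_; con)

  IsMotzkin : Carrier → Carrier → (ℕ → Carrier) → Set ℓ
  IsMotzkin A B M = M 0 ≈ 1# × (∀ m → M (suc m) ≈ A * M m + B * shift (M ⋆ M) m)

  IsMotzkin-resp : ∀ {A B M M′} → (∀ m → M m ≈ M′ m) → IsMotzkin A B M → IsMotzkin A B M′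
  IsMotzkin-resp M≈ (M₀ , M-suc) =
    trans (sym (M≈ 0)) M₀ ,
    λ m → trans (sym (M≈ (suc m)))
            (trans (M-suc m) (+-cong (*-congˡ (M≈ m)) (*-congˡ (shift-cong (λ i → ⋆-cong i M≈ M≈) m))))

  IsMotzkin-cong : ∀ {A A′ B B′ M} → A ≈ A′ → B ≈ B′ → IsMotzkin A B M → IsMotzkin A′ B′ M
  IsMotzkin-cong A≈ B≈ (M₀ , M-suc) = M₀ , λ m → trans (M-suc m) (+-cong (*-congʳ A≈) (*-congʳ B≈))

  -- The hypotheses are the first-return decomposition of Catalan paths (y m counts the paths
  -- of order m preceded by an E step); substituting y leaves the Motzkin recurrence for x (suc m) / a.
  catalan-motzkin : ∀ a b (x y M : ℕ → Carrier) → IsMotzkin (a + b) (a * b) M →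
                    x 0 ≈ 1# → y 0 ≈ a →
                    (∀ m → x (suc m) ≈ (x ⋆ y) m) → (∀ m → y (suc m) ≈ b * x (suc m)) →
                    ∀ m → x (suc m) ≈ a * M m
  catalan-motzkin a b x y M (M₀ , M-suc) x₀ y₀ x-suc y-suc = <-rec _ step
    where
    step : ∀ m → (∀ {j} → j < m → x (suc j) ≈ a * M j) → x (suc m) ≈ a * M m
    step zero    _  = begin
      x 1          ≈⟨ x-suc 0 ⟩
      x 0 * y 0    ≈⟨ *-cong x₀ y₀ ⟩
      1# * a       ≈⟨ *-comm 1# a ⟩
      a * 1#       ≈⟨ *-congˡ M₀ ⟨
      a * M 0      ∎
    step (suc j) ih = begin
        x (suc (suc j))
      ≈⟨ x-suc (suc j) ⟩
        x 0 * y (suc j) + (tail x ⋆ y) j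
      ≈⟨ +-cong (trans (*-cong x₀ (y-tail ≤-refl)) (*-identityˡ _))
                (trans (⋆-cong-≤ j (λ i i≤j → ih (s≤s i≤j)) (λ _ _ → refl)) (⋆-*ˡ a M y j)) ⟩
        (b * a) * M j + a * (M ⋆ y) j
      ≈⟨ +-congˡ (*-congˡ M⋆y) ⟩
        (b * a) * M j + a * (M j * a + (b * a) * shift (M ⋆ M) j)
      ≈⟨ solve 4 (λ a b m s → ((b :* a) :* m :+ a :* (m :* a :+ (b :* a) :* s))
                              := a :* ((a :+ b) :* m :+ (a :* b) :* s)) refl a b (M j) (shift (M ⋆ M) j) ⟩
        a * ((a + b) * M j + (a * b) * shift (M ⋆ M) j)
      ≈⟨ *-congˡ (M-suc j) ⟨
        a * M (suc j) ∎
      where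
      y-tail : ∀ {i} → i < suc j → y (suc i) ≈ (b * a) * M i
      y-tail i<m = trans (y-suc _) (trans (*-congˡ (ih i<m)) (sym (*-assoc b a _)))
      M⋆y : (M ⋆ y) j ≈ M j * a + (b * a) * shift (M ⋆ M) j
      M⋆y = trans (⋆-unfoldʳ M y j)
              (+-cong (*-congˡ y₀) (shift-⋆-*ʳ (b * a) M M (tail y) j (λ _ i<j → y-tail (m≤n⇒m≤1+n i<j))))

  schroder-motzkin : ∀ a b (v M : ℕ → Carrier) → IsMotzkin (a + b + b) (a * b + b * b) M →
                     v 0 ≈ 1# → (∀ m → v (suc m) ≈ b * (v ⋆ v) m + a * v m) →
                     ∀ m → v (suc m) ≈ (a + b) * M m
  schroder-motzkin a b v M (M₀ , M-suc) v₀ v-suc = <-rec _ step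
    where
    step : ∀ m → (∀ {j} → j < m → v (suc j) ≈ (a + b) * M j) → v (suc m) ≈ (a + b) * M m
    step zero    _  = begin
      v 1                       ≈⟨ v-suc 0 ⟩
      b * (v 0 * v 0) + a * v 0 ≈⟨ +-cong (*-congˡ (*-cong v₀ v₀)) (*-congˡ v₀) ⟩
      b * (1# * 1#) + a * 1#    ≈⟨ solve 2 (λ a b → b :* (con 1 :* con 1) :+ a :* con 1 := (a :+ b) :* con 1)
                                         refl a b ⟩
      (a + b) * 1#              ≈⟨ *-congˡ M₀ ⟨
      (a + b) * M 0             ∎
    step (suc j) ih = begin
        v (suc (suc j))
      ≈⟨ v-suc (suc j) ⟩
        b * (v 0 * v (suc j) + (tail v ⋆ v) j) + a * v (suc j)
      ≈⟨ +-cong (*-congˡ (+-cong (trans (*-congʳ v₀) (*-identityˡ _)) (trans tail-v (⋆-*ˡ (a + b) M v j))))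
                (*-congˡ (ih ≤-refl)) ⟩
        b * (v (suc j) + (a + b) * (M ⋆ v) j) + a * ((a + b) * M j)
      ≈⟨ +-congʳ (*-congˡ (+-cong (ih ≤-refl) (*-congˡ M⋆v))) ⟩
        b * ((a + b) * M j + (a + b) * (M j + (a + b) * shift (M ⋆ M) j)) + a * ((a + b) * M j)
      ≈⟨ solve 4 (λ a b m s → b :* ((a :+ b) :* m :+ (a :+ b) :* (m :+ (a :+ b) :* s)) :+ a :* ((a :+ b) :* m)
                              := (a :+ b) :* ((a :+ b :+ b) :* m :+ (a :* b :+ b :* b) :* s))
                 refl a b (M j) (shift (M ⋆ M) j) ⟩
        (a + b) * ((a + b + b) * M j + (a * b + b * b) * shift (M ⋆ M) j)
      ≈⟨ *-congˡ (M-suc j) ⟨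
        (a + b) * M (suc j) ∎
      where
      tail-v : (tail v ⋆ v) j ≈ ((λ i → (a + b) * M i) ⋆ v) j
      tail-v = ⋆-cong-≤ j (λ i i≤j → ih (s≤s i≤j)) (λ _ _ → refl)
      M⋆v : (M ⋆ v) j ≈ M j + (a + b) * shift (M ⋆ M) j
      M⋆v = trans (⋆-unfoldʳ M v j)
              (+-cong (trans (*-congˡ v₀) (*-identityʳ _))
                      (shift-⋆-*ʳ (a + b) M M (tail v) j (λ _ i<j → ih (m≤n⇒m≤1+n i<j))))

module MotzkinCounts {c ℓ} (R : CommutativeRing c ℓ) (A B : CommutativeRing.Carrier R) where
  open CommutativeRing R
  open Weights R
  open ListSums R
  open CauchyProduct R
  open Recurrences R using (IsMotzkin; IsMotzkin-resp)
  open import Algebra.Properties.CommutativeSemigroup *-commutativeSemigroup using (x∙yz≈y∙xz)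
  open import Relation.Binary.Reasoning.Setoid setoid
  open import Algebra.Solver.Ring.NaturalCoefficients.Default commutativeSemiring using (solve; _:=_; _:+_; _:*_)

  weight : List MStep → Carrier
  weight []       = 1#
  weight (D ∷ w)  = A * weight w
  weight (N₂ ∷ w) = weight w
  weight (E₂ ∷ w) = B * weight w

  W : ℕ → ℕ → Carrier
  W h m = sumOver (λ w → if mValidFrom h w then weight w else 0#) (words mAlphabet m)

  pow-weight : ∀ w → pow A (mNumD w) * pow B (mNumE₂ w) ≈ weight w
  pow-weight []       = *-identityˡ _
  pow-weight (D ∷ w)  = trans (*-assoc _ _ _) (*-congˡ (pow-weight w))
  pow-weight (N₂ ∷ w) = pow-weight w
  pow-weight (E₂ ∷ w) = trans (x∙yz≈y∙xz _ _ _) (*-congˡ (pow-weight w))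

  Mot≈W : ∀ m → Mot A B m ≈ W 0 m
  Mot≈W m = trans (sumOver-filter (mValidFrom 0) _ (words mAlphabet m))
                  (sumOver-cong (λ w → if-cong (mValidFrom 0 w) (pow-weight w)) (words mAlphabet m))

  W-zero-zero : W 0 0 ≈ 1#
  W-zero-zero = +-identityʳ _

  W-suc-zero : ∀ h → W (suc h) 0 ≈ 0#
  W-suc-zero h = +-identityʳ _

  W-zero-suc : ∀ m → W 0 (suc m) ≈ A * W 0 m + W 2 m
  W-zero-suc m = trans (sumOver-words-suc mAlphabet _ m)
    (+-cong (sumOver-if-*ˡ (mValidFrom 0) A weight ws)
            (trans (+-congˡ (trans (+-identityʳ _) (sumOver-zero ws))) (+-identityʳ _)))
    where
    ws : List (List MStep)
    ws = words mAlphabet m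

  W-2+-suc : ∀ h m → W (suc (suc h)) (suc m) ≈ A * W (suc (suc h)) m + (W (suc (suc (suc (suc h)))) m + B * W h m)
  W-2+-suc h m = trans (sumOver-words-suc mAlphabet _ m)
    (+-cong (sumOver-if-*ˡ (mValidFrom (suc (suc h))) A weight ws)
            (+-congˡ (trans (+-identityʳ _) (sumOver-if-*ˡ (mValidFrom h) B weight ws))))
    where
    ws : List (List MStep)
    ws = words mAlphabet m

  -- Cut a path from height h+2 at its first visit to height h.
  W-first-passage : ∀ t h → W (suc (suc h)) t ≈ B * shift (W 0 ⋆ W h) t
  W-first-passage = <-rec _ step
    where
    step : ∀ t → (∀ {s} → s < t → ∀ h → W (suc (suc h)) s ≈ B * shift (W 0 ⋆ W h) s) →
           ∀ h → W (suc (suc h)) t ≈ B * shift (W 0 ⋆ W h) t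
    step zero          _  h = trans (W-suc-zero (suc h)) (sym (zeroʳ B))
    step (suc zero)    _  h = begin
        W (suc (suc h)) 1
      ≈⟨ W-2+-suc h 0 ⟩
        A * W (suc (suc h)) 0 + (W (suc (suc (suc (suc h)))) 0 + B * W h 0)
      ≈⟨ +-cong (trans (*-congˡ (W-suc-zero (suc h))) (zeroʳ A)) (+-congʳ (W-suc-zero (suc (suc (suc h))))) ⟩
        0# + (0# + B * W h 0)
      ≈⟨ trans (+-identityˡ _) (+-identityˡ _) ⟩
        B * W h 0
      ≈⟨ *-congˡ (trans (sym (*-identityˡ _)) (*-congʳ (sym W-zero-zero))) ⟩
        B * (W 0 0 * W h 0) ∎
    step (suc (suc m)) ih h = begin
        W (suc (suc h)) (suc (suc m))
      ≈⟨ W-2+-suc h (suc m) ⟩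
        A * W (suc (suc h)) (suc m) + (W (suc (suc (suc (suc h)))) (suc m) + B * W h (suc m))
      ≈⟨ +-cong (*-congˡ (ih ≤-refl h)) (+-congʳ (ih ≤-refl (suc (suc h)))) ⟩
        A * (B * (W 0 ⋆ W h) m) + (B * (W 0 ⋆ W (suc (suc h))) m + B * W h (suc m))
      ≈⟨ solve 5 (λ A B x y z → A :* (B :* x) :+ (B :* y :+ B :* z) := B :* (z :+ (A :* x :+ y)))
                 refl A B ((W 0 ⋆ W h) m) ((W 0 ⋆ W (suc (suc h))) m) (W h (suc m)) ⟩
        B * (W h (suc m) + (A * (W 0 ⋆ W h) m + (W 0 ⋆ W (suc (suc h))) m))
      ≈⟨ *-congˡ (+-cong (trans (sym (*-identityˡ _)) (*-congʳ (sym W-zero-zero))) (sym tail-W₀)) ⟩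
        B * (W 0 ⋆ W h) (suc m) ∎
      where
      earlier : ∀ h′ i → i ≤ m → W (suc (suc h′)) i ≈ B * shift (W 0 ⋆ W h′) i
      earlier h′ i i≤m = ih (m≤n⇒m<2+n i≤m) h′
      tail-W₀ : (tail (W 0) ⋆ W h) m ≈ A * (W 0 ⋆ W h) m + (W 0 ⋆ W (suc (suc h))) m
      tail-W₀ = begin
        (tail (W 0) ⋆ W h) m                        ≈⟨ ⋆-cong m W-zero-suc (λ _ → refl) ⟩
        ((λ i → A * W 0 i + W 2 i) ⋆ W h) m          ≈⟨ ⋆-distribʳ (λ i → A * W 0 i) (W 2) (W h) m ⟩
        ((λ i → A * W 0 i) ⋆ W h) m + (W 2 ⋆ W h) m ≈⟨ +-cong (⋆-*ˡ A (W 0) (W h) m)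
                                                        (⋆-reassoc-≤ B (W 0) (W 0) (W h) m (earlier 0) (earlier h)) ⟩
        A * (W 0 ⋆ W h) m + (W 0 ⋆ W (suc (suc h))) m ∎

  Mot-motzkin : IsMotzkin A B (Mot A B)
  Mot-motzkin = IsMotzkin-resp (λ m → sym (Mot≈W m))
    (W-zero-zero , λ m → trans (W-zero-suc m) (+-congˡ (W-first-passage m 0)))

module CatalanCounts {c ℓ} (R : CommutativeRing c ℓ) (a b : CommutativeRing.Carrier R) where
  open CommutativeRing R
  open Weights R
  open ListSums R
  open CauchyProduct R
  open Recurrences R using (IsMotzkin; catalan-motzkin)
  open import Relation.Binary.Reasoning.Setoid setoid
  open import Algebra.Properties.CommutativeSemigroup *-commutativeSemigroup using (x∙yz≈y∙xz)

  weight : List CStep → Carrier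
  weight []          = 1#
  weight (N ∷ w)     = weight w
  weight (E ∷ [])    = a
  weight (E ∷ N ∷ w) = b * weight w
  weight (E ∷ E ∷ w) = a * weight (E ∷ w)

  countE : List CStep → ℕ
  countE []      = 0
  countE (N ∷ w) = countE w
  countE (E ∷ w) = suc (countE w)

  valley≤countE : ∀ w → valley w ≤ countE w
  valley≤countE []          = z≤n
  valley≤countE (N ∷ w)     = valley≤countE w
  valley≤countE (E ∷ [])    = z≤n
  valley≤countE (E ∷ N ∷ w) = s≤s (valley≤countE w)
  valley≤countE (E ∷ E ∷ w) = m≤n⇒m≤1+n (valley≤countE (E ∷ w))

  weight-closed : ∀ w → weight w ≈ pow a (countE w ∸ valley w) * pow b (valley w)
  weight-closed []          = sym (*-identityˡ _)
  weight-closed (N ∷ w)     = weight-closed w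
  weight-closed (E ∷ [])    = sym (trans (*-identityʳ _) (*-identityʳ _))
  weight-closed (E ∷ N ∷ w) = trans (*-congˡ (weight-closed w)) (x∙yz≈y∙xz _ _ _)
  weight-closed (E ∷ E ∷ w) =
    trans (*-congˡ (weight-closed (E ∷ w)))
      (trans (sym (*-assoc _ _ _))
        (*-congʳ (reflexive (≡.cong (pow a) (≡.sym (+-∸-assoc 1 (valley≤countE (E ∷ w))))))))

  countE-double : ∀ h w → T (cValidFrom h w) → countE w ℕ.+ countE w ≡ length w ℕ.+ h
  countE-double h       []      valid = ≡.sym (≡ᵇ⇒≡ h 0 valid)
  countE-double h       (N ∷ w) valid = ≡.trans (countE-double (suc h) w valid) (+-suc _ h)
  countE-double (suc h) (E ∷ w) valid =
    ≡.cong suc (≡.trans (+-suc _ _) (≡.trans (≡.cong suc (countE-double h w valid)) (≡.sym (+-suc _ h))))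

  X Y : ℕ → ℕ → Carrier
  X h k = sumOver (λ w → if cValidFrom h w then weight w else 0#) (words cAlphabet k)
  Y h k = sumOver (λ w → if cValidFrom h w then weight (E ∷ w) else 0#) (words cAlphabet k)

  Cat≈X : ∀ n → Cat a b n ≈ X 0 (n ℕ.+ n)
  Cat≈X n = trans (sumOver-filter (cValidFrom 0) _ (words cAlphabet (n ℕ.+ n)))
                  (sumOver-words-cong cAlphabet (n ℕ.+ n) pointwise)
    where
    pointwise : ∀ w → length w ≡ n ℕ.+ n →
                (if cValidFrom 0 w then pow a (n ∸ valley w) * pow b (valley w) else 0#) ≈
                (if cValidFrom 0 w then weight w else 0#)
    pointwise w len with cValidFrom 0 w in valid
    ... | false = refl
    ... | true  = sym (trans (weight-closed w)
                        (reflexive (≡.cong (λ e → pow a (e ∸ valley w) * pow b (valley w)) countE≡n)))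
      where
      countE≡n : countE w ≡ n
      countE≡n = ≡.trans (n≡⌊n+n/2⌋ _)
                   (≡.trans (≡.cong ⌊_/2⌋ (≡.trans (countE-double 0 w (≡.subst T (≡.sym valid) _))
                                                   (≡.trans (ℕₚ.+-identityʳ _) len)))
                            (≡.sym (n≡⌊n+n/2⌋ n)))

  X-zero-zero : X 0 0 ≈ 1#
  X-zero-zero = +-identityʳ _

  Y-zero-zero : Y 0 0 ≈ a
  Y-zero-zero = +-identityʳ _

  X-suc-zero : ∀ h → X (suc h) 0 ≈ 0#
  X-suc-zero h = +-identityʳ _

  Y-suc-zero : ∀ h → Y (suc h) 0 ≈ 0#
  Y-suc-zero h = +-identityʳ _

  X-zero-suc : ∀ k → X 0 (suc k) ≈ X 1 k
  X-zero-suc k = trans (sumOver-words-suc cAlphabet _ k)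
    (trans (+-congˡ (trans (+-identityʳ _) (sumOver-zero (words cAlphabet k)))) (+-identityʳ _))

  X-suc-suc : ∀ h k → X (suc h) (suc k) ≈ X (suc (suc h)) k + Y h k
  X-suc-suc h k = trans (sumOver-words-suc cAlphabet _ k) (+-congˡ (+-identityʳ _))

  Y-zero-suc : ∀ k → Y 0 (suc k) ≈ b * X 1 k
  Y-zero-suc k = trans (sumOver-words-suc cAlphabet _ k)
    (trans (+-cong (sumOver-if-*ˡ (cValidFrom 1) b weight ws) (trans (+-identityʳ _) (sumOver-zero ws)))
           (+-identityʳ _))
    where
    ws : List (List CStep)
    ws = words cAlphabet k

  Y-suc-suc : ∀ h k → Y (suc h) (suc k) ≈ b * X (suc (suc h)) k + a * Y h k
  Y-suc-suc h k = trans (sumOver-words-suc cAlphabet _ k)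
    (+-cong (sumOver-if-*ˡ (cValidFrom (suc (suc h))) b weight ws)
            (trans (+-identityʳ _) (sumOver-if-*ˡ (cValidFrom h) a (λ w → weight (E ∷ w)) ws)))
    where
    ws : List (List CStep)
    ws = words cAlphabet k

  XY-odd : ∀ t h → parity (h ℕ.+ t) ≡ 1ℙ → X h t ≈ 0# × Y h t ≈ 0#
  XY-odd zero    (suc h) _   = X-suc-zero h , Y-suc-zero h
  XY-odd (suc t) zero    odd =
    trans (X-zero-suc t) X₁ , trans (Y-zero-suc t) (trans (*-congˡ X₁) (zeroʳ b))
    where
    X₁ : X 1 t ≈ 0#
    X₁ = proj₁ (XY-odd t 1 odd)
  XY-odd (suc t) (suc h) odd =
    trans (X-suc-suc h t) (trans (+-cong X₂ Y₀) (+-identityʳ _)) ,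
    trans (Y-suc-suc h t) (trans (+-cong (trans (*-congˡ X₂) (zeroʳ b)) (trans (*-congˡ Y₀) (zeroʳ a)))
                                 (+-identityʳ _))
    where
    odd′ : parity (h ℕ.+ t) ≡ 1ℙ
    odd′ = ≡.trans (≡.sym (parity-suc-+-suc h t)) odd
    X₂ : X (suc (suc h)) t ≈ 0#
    X₂ = proj₁ (XY-odd t (suc (suc h)) odd′)
    Y₀ : Y h t ≈ 0#
    Y₀ = proj₂ (XY-odd t h odd′)

  -- Cut a path from height h+1 at its first visit to height h, which is an E step.
  XY-first-passage : ∀ t h → X (suc h) t ≈ shift (X 0 ⋆ Y h) t × Y (suc h) t ≈ shift (Y 0 ⋆ Y h) t
  XY-first-passage = <-rec _ step
    where
    P : ℕ → Set ℓ
    P t = ∀ h → X (suc h) t ≈ shift (X 0 ⋆ Y h) t × Y (suc h) t ≈ shift (Y 0 ⋆ Y h) t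
    step : ∀ t → (∀ {s} → s < t → P s) → P t
    step zero          _  h = X-suc-zero h , Y-suc-zero h
    step (suc zero)    _  h =
      trans (X-suc-suc h 0) (trans (+-congʳ (X-suc-zero (suc h)))
        (trans (+-identityˡ _) (sym (trans (*-congʳ X-zero-zero) (*-identityˡ _))))) ,
      trans (Y-suc-suc h 0) (trans (+-congʳ (trans (*-congˡ (X-suc-zero (suc h))) (zeroʳ b)))
        (trans (+-identityˡ _) (*-congʳ (sym Y-zero-zero))))
    step (suc (suc m)) ih h = X-step , Y-step
      where
      X-prev : X (suc (suc h)) (suc m) ≈ (X 0 ⋆ Y (suc h)) m
      X-prev = proj₁ (ih ≤-refl (suc h))
      reassoc : (X 1 ⋆ Y h) m ≈ (X 0 ⋆ Y (suc h)) m
      reassoc = ⋆-reassoc-≤ 1# (X 0) (Y 0) (Y h) m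
        (λ i i≤m → trans (proj₁ (ih (m≤n⇒m<2+n i≤m) 0)) (sym (*-identityˡ _)))
        (λ i i≤m → trans (proj₂ (ih (m≤n⇒m<2+n i≤m) h)) (sym (*-identityˡ _)))
      tail-X₀ : (tail (X 0) ⋆ Y h) m ≈ (X 0 ⋆ Y (suc h)) m
      tail-X₀ = trans (⋆-cong m X-zero-suc (λ _ → refl)) reassoc
      X-step : X (suc h) (suc (suc m)) ≈ (X 0 ⋆ Y h) (suc m)
      X-step = begin
        X (suc h) (suc (suc m))               ≈⟨ X-suc-suc h (suc m) ⟩
        X (suc (suc h)) (suc m) + Y h (suc m)   ≈⟨ +-comm _ _ ⟩
        Y h (suc m) + X (suc (suc h)) (suc m)   ≈⟨ +-congˡ X-prev ⟩
        Y h (suc m) + (X 0 ⋆ Y (suc h)) m       ≈⟨ +-cong (sym (trans (*-congʳ X-zero-zero) (*-identityˡ _))) (sym tail-X₀) ⟩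
        (X 0 ⋆ Y h) (suc m)                   ∎
      Y-step : Y (suc h) (suc (suc m)) ≈ (Y 0 ⋆ Y h) (suc m)
      Y-step = begin
        Y (suc h) (suc (suc m))                       ≈⟨ Y-suc-suc h (suc m) ⟩
        b * X (suc (suc h)) (suc m) + a * Y h (suc m)   ≈⟨ +-comm _ _ ⟩
        a * Y h (suc m) + b * X (suc (suc h)) (suc m)   ≈⟨ +-congˡ (*-congˡ X-prev) ⟩
        a * Y h (suc m) + b * (X 0 ⋆ Y (suc h)) m       ≈⟨ +-cong (*-congʳ (sym Y-zero-zero)) (sym tail-Y₀) ⟩
        (Y 0 ⋆ Y h) (suc m)                           ∎
        where
        tail-Y₀ : (tail (Y 0) ⋆ Y h) m ≈ b * (X 0 ⋆ Y (suc h)) m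
        tail-Y₀ = trans (⋆-cong m Y-zero-suc (λ _ → refl))
                        (trans (⋆-*ˡ b (X 1) (Y h) m) (*-congˡ reassoc))

  x y : ℕ → Carrier
  x m = X 0 (m ℕ.+ m)
  y m = Y 0 (m ℕ.+ m)

  x-suc : ∀ m → x (suc m) ≈ (x ⋆ y) m
  x-suc m = begin
    X 0 (suc m ℕ.+ suc m)         ≡⟨ ≡.cong (X 0) (double-suc m) ⟩
    X 0 (suc (suc (m ℕ.+ m)))     ≈⟨ X-zero-suc (suc (m ℕ.+ m)) ⟩
    X 1 (suc (m ℕ.+ m))           ≈⟨ proj₁ (XY-first-passage (suc (m ℕ.+ m)) 0) ⟩
    (X 0 ⋆ Y 0) (m ℕ.+ m)         ≈⟨ ⋆-even (X 0) (Y 0) (λ i → proj₁ (XY-odd (suc (i ℕ.+ i)) 0 (parity-odd i))) m ⟩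
    (x ⋆ y) m                     ∎

  y-suc : ∀ m → y (suc m) ≈ b * x (suc m)
  y-suc m = begin
    Y 0 (suc m ℕ.+ suc m)         ≡⟨ ≡.cong (Y 0) (double-suc m) ⟩
    Y 0 (suc (suc (m ℕ.+ m)))     ≈⟨ Y-zero-suc (suc (m ℕ.+ m)) ⟩
    b * X 1 (suc (m ℕ.+ m))       ≈⟨ *-congˡ (X-zero-suc (suc (m ℕ.+ m))) ⟨
    b * X 0 (suc (suc (m ℕ.+ m))) ≡⟨ ≡.cong (λ k → b * X 0 k) (≡.sym (double-suc m)) ⟩
    b * X 0 (suc m ℕ.+ suc m)     ∎

  Cat-motzkin : ∀ M → IsMotzkin (a + b) (a * b) M → ∀ m → Cat a b (suc m) ≈ a * M m
  Cat-motzkin M M-motzkin m =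
    trans (Cat≈X (suc m)) (catalan-motzkin a b x y M M-motzkin X-zero-zero Y-zero-zero x-suc y-suc m)

module SchroderCounts {c ℓ} (R : CommutativeRing c ℓ) (a b : CommutativeRing.Carrier R) where
  open CommutativeRing R
  open Weights R
  open ListSums R
  open CauchyProduct R
  open Recurrences R using (IsMotzkin; schroder-motzkin)
  open import Relation.Binary.Reasoning.Setoid setoid
  open import Algebra.Properties.CommutativeSemigroup *-commutativeSemigroup using (x∙yz≈y∙xz)
  open import Algebra.Solver.Ring.NaturalCoefficients.Default commutativeSemiring using (solve; _:=_; _:+_; _:*_)

  weight : List SStep → Carrier
  weight []      = 1#
  weight (N ∷ w) = weight w
  weight (E ∷ w) = b * weight w
  weight (D ∷ w) = a * weight w

  pow-weight : ∀ w → pow a (numD w) * pow b (numE w) ≈ weight w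
  pow-weight []      = *-identityˡ _
  pow-weight (N ∷ w) = pow-weight w
  pow-weight (E ∷ w) = trans (x∙yz≈y∙xz _ _ _) (*-congˡ (pow-weight w))
  pow-weight (D ∷ w) = trans (*-assoc _ _ _) (*-congˡ (pow-weight w))

  -- The increase of x + y along a path: a D step counts twice.
  time : List SStep → ℕ
  time []      = 0
  time (N ∷ w) = suc (time w)
  time (E ∷ w) = suc (time w)
  time (D ∷ w) = suc (suc (time w))

  length≤time : ∀ w → length w ≤ time w
  length≤time []      = z≤n
  length≤time (N ∷ w) = s≤s (length≤time w)
  length≤time (E ∷ w) = s≤s (length≤time w)
  length≤time (D ∷ w) = m≤n⇒m≤1+n (s≤s (length≤time w))

  time-valid : ∀ h w → T (sValidFrom h w) → time w ℕ.+ h ≡ sWidth w ℕ.+ sWidth w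
  time-valid h       []      valid = ≡ᵇ⇒≡ h 0 valid
  time-valid h       (N ∷ w) valid = ≡.trans (≡.sym (+-suc _ h)) (time-valid (suc h) w valid)
  time-valid (suc h) (E ∷ w) valid =
    ≡.cong suc (≡.trans (+-suc _ h) (≡.trans (≡.cong suc (time-valid h w valid)) (≡.sym (+-suc _ _))))
  time-valid h       (D ∷ w) valid =
    ≡.cong suc (≡.trans (≡.cong suc (time-valid h w valid)) (≡.sym (+-suc _ _)))

  -- Paths from height h with L steps and time t; V sums over all lengths, which are at most t.
  U : ℕ → ℕ → ℕ → Carrier
  U h L t = sumOver (λ w → if (time w ≡ᵇ t) ∧ sValidFrom h w then weight w else 0#) (words sAlphabet L)

  V : ℕ → ℕ → Carrier
  V h t = sumOver (λ L → U h L t) (upTo (suc t))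

  U-vanish : ∀ h L t → t < L → U h L t ≈ 0#
  U-vanish h L t t<L = trans (sumOver-words-cong sAlphabet L vanish) (sumOver-zero (words sAlphabet L))
    where
    vanish : ∀ w → length w ≡ L → (if (time w ≡ᵇ t) ∧ sValidFrom h w then weight w else 0#) ≈ 0#
    vanish w len with time w ≡ᵇ t in time≡t
    ... | false = refl
    ... | true  = ⊥-elim (<⇒≱ t<L (≡.subst (_≤ t) len
                    (≤-trans (length≤time w) (≤-reflexive (≡ᵇ⇒≡ _ _ (≡.subst T (≡.sym time≡t) _))))))

  private
    if-∧-false : ∀ (p : Bool) x → (if p ∧ false then x else 0#) ≈ 0#
    if-∧-false true  x = refl
    if-∧-false false x = refl

    D-part : ∀ h L t → sumOver (λ w → if (time (D ∷ w) ≡ᵇ suc t) ∧ sValidFrom h (D ∷ w) then weight (D ∷ w) else 0#)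
                                 (words sAlphabet L)
                       ≈ a * shift (U h L) t
    D-part h L zero    = trans (sumOver-zero (words sAlphabet L)) (sym (zeroʳ a))
    D-part h L (suc t) = sumOver-if-*ˡ (λ w → (time w ≡ᵇ t) ∧ sValidFrom h w) a weight (words sAlphabet L)

  U-zero-suc : ∀ L t → U 0 (suc L) (suc t) ≈ U 1 L t + a * shift (U 0 L) t
  U-zero-suc L t = trans (sumOver-words-suc sAlphabet _ L)
    (+-congˡ (trans (+-cong E-part (+-identityʳ _)) (trans (+-identityˡ _) (D-part 0 L t))))
    where
    E-part : sumOver (λ w → if (time w ≡ᵇ t) ∧ false then b * weight w else 0#) (words sAlphabet L) ≈ 0#
    E-part = trans (sumOver-cong (λ w → if-∧-false (time w ≡ᵇ t) _) (words sAlphabet L))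
                   (sumOver-zero (words sAlphabet L))

  U-suc-suc : ∀ h L t → U (suc h) (suc L) (suc t) ≈ U (suc (suc h)) L t + (b * U h L t + a * shift (U (suc h) L) t)
  U-suc-suc h L t = trans (sumOver-words-suc sAlphabet _ L)
    (+-congˡ (+-cong (sumOver-if-*ˡ (λ w → (time w ≡ᵇ t) ∧ sValidFrom h w) b weight (words sAlphabet L))
                     (trans (+-identityʳ _) (D-part (suc h) L t))))

  V-zero-zero : V 0 0 ≈ 1#
  V-zero-zero = trans (+-identityʳ _) (+-identityʳ _)

  V-suc-zero : ∀ h → V (suc h) 0 ≈ 0#
  V-suc-zero h = trans (+-identityʳ _) (+-identityʳ _)

  V-suc : ∀ h t → V h (suc t) ≈ sumOver (λ L → U h (suc L) (suc t)) (upTo (suc t))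
  V-suc h t = trans (sumOver-upTo-suc (λ L → U h L (suc t)) (suc t)) (trans (+-congʳ (+-identityʳ _)) (+-identityˡ _))

  sumOver-shift-U : ∀ h t → sumOver (λ L → shift (U h L) t) (upTo (suc t)) ≈ shift (V h) t
  sumOver-shift-U h zero    = +-identityʳ _
  sumOver-shift-U h (suc t) = trans (sumOver-upTo-last (λ L → U h L t) (suc t))
                                    (trans (+-congˡ (U-vanish h (suc t) t ≤-refl)) (+-identityʳ _))

  V-zero-suc : ∀ t → V 0 (suc t) ≈ V 1 t + a * shift (V 0) t
  V-zero-suc t = begin
    V 0 (suc t)                                     ≈⟨ V-suc 0 t ⟩
    sumOver (λ L → U 0 (suc L) (suc t)) Ls          ≈⟨ sumOver-cong (λ L → U-zero-suc L t) Ls ⟩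
    sumOver (λ L → U 1 L t + a * shift (U 0 L) t) Ls ≈⟨ sumOver-+ _ _ Ls ⟩
    V 1 t + sumOver (λ L → a * shift (U 0 L) t) Ls  ≈⟨ +-congˡ (sumOver-*ˡ a _ Ls) ⟩
    V 1 t + a * sumOver (λ L → shift (U 0 L) t) Ls  ≈⟨ +-congˡ (*-congˡ (sumOver-shift-U 0 t)) ⟩
    V 1 t + a * shift (V 0) t                       ∎
    where
    Ls : List ℕ
    Ls = upTo (suc t)

  V-suc-suc : ∀ h t → V (suc h) (suc t) ≈ V (suc (suc h)) t + (b * V h t + a * shift (V (suc h)) t)
  V-suc-suc h t = begin
    V (suc h) (suc t)
      ≈⟨ V-suc (suc h) t ⟩
    sumOver (λ L → U (suc h) (suc L) (suc t)) Ls
      ≈⟨ sumOver-cong (λ L → U-suc-suc h L t) Ls ⟩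
    sumOver (λ L → U (suc (suc h)) L t + (b * U h L t + a * shift (U (suc h) L) t)) Ls
      ≈⟨ trans (sumOver-+ _ _ Ls) (+-congˡ (sumOver-+ _ _ Ls)) ⟩
    V (suc (suc h)) t + (sumOver (λ L → b * U h L t) Ls + sumOver (λ L → a * shift (U (suc h) L) t) Ls)
      ≈⟨ +-congˡ (+-cong (sumOver-*ˡ b _ Ls) (trans (sumOver-*ˡ a _ Ls) (*-congˡ (sumOver-shift-U (suc h) t)))) ⟩
    V (suc (suc h)) t + (b * V h t + a * shift (V (suc h)) t)
      ∎
    where
    Ls : List ℕ
    Ls = upTo (suc t)

  Sch≈V : ∀ n → Sch a b n ≈ V 0 (n ℕ.+ n)
  Sch≈V n = begin
    Sch a b n
      ≈⟨ sumOver-filter (λ w → sValidFrom 0 w ∧ (sWidth w ≡ᵇ n)) _ (wordsUpTo sAlphabet (n ℕ.+ n)) ⟩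
    sumOver F (concatMap (words sAlphabet) (upTo (suc (n ℕ.+ n))))
      ≈⟨ sumOver-concatMap F (words sAlphabet) (upTo (suc (n ℕ.+ n))) ⟩
    sumOver (λ L → sumOver F (words sAlphabet L)) (upTo (suc (n ℕ.+ n)))
      ≈⟨ sumOver-cong (λ L → sumOver-cong pointwise (words sAlphabet L)) (upTo (suc (n ℕ.+ n))) ⟩
    V 0 (n ℕ.+ n) ∎
    where
    F : List SStep → Carrier
    F w = if sValidFrom 0 w ∧ (sWidth w ≡ᵇ n) then pow a (numD w) * pow b (numE w) else 0#
    pointwise : ∀ w → F w ≈ (if (time w ≡ᵇ n ℕ.+ n) ∧ sValidFrom 0 w then weight w else 0#)
    pointwise w with sValidFrom 0 w in valid
    ... | false = sym (if-∧-false (time w ≡ᵇ n ℕ.+ n) _)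
    ... | true  = trans (if-cong (sWidth w ≡ᵇ n) (pow-weight w))
                        (reflexive (≡.cong (λ p → if p then weight w else 0#) width≡ᵇn⇔time≡ᵇ2n))
      where
      time≡2width : time w ≡ sWidth w ℕ.+ sWidth w
      time≡2width = ≡.trans (≡.sym (ℕₚ.+-identityʳ _)) (time-valid 0 w (≡.subst T (≡.sym valid) _))
      width≡ᵇn⇔time≡ᵇ2n : (sWidth w ≡ᵇ n) ≡ ((time w ≡ᵇ n ℕ.+ n) ∧ true)
      width≡ᵇn⇔time≡ᵇ2n = ≡.trans (≡.sym (double-≡ᵇ (sWidth w) n))
                            (≡.trans (≡.cong (_≡ᵇ n ℕ.+ n) (≡.sym time≡2width)) (≡.sym (∧-identityʳ _)))

  mutual
    V-odd : ∀ t h → parity (h ℕ.+ t) ≡ 1ℙ → V h t ≈ 0#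
    V-odd zero    (suc h) _   = V-suc-zero h
    V-odd (suc t) zero    odd =
      trans (V-zero-suc t) (trans (+-cong (V-odd t 1 odd) (trans (*-congˡ (shift-V-odd t 0 odd)) (zeroʳ a)))
                                  (+-identityʳ _))
    V-odd (suc t) (suc h) odd =
      trans (V-suc-suc h t)
        (trans (+-cong (V-odd t (suc (suc h)) odd′)
                       (+-cong (trans (*-congˡ (V-odd t h odd′)) (zeroʳ b))
                               (trans (*-congˡ (shift-V-odd t (suc h) odd)) (zeroʳ a))))
               (trans (+-identityˡ _) (+-identityˡ _)))
      where
      odd′ : parity (h ℕ.+ t) ≡ 1ℙ
      odd′ = ≡.trans (≡.sym (parity-suc-+-suc h t)) odd

    shift-V-odd : ∀ t h → parity (h ℕ.+ suc t) ≡ 1ℙ → shift (V h) t ≈ 0#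
    shift-V-odd zero    h _   = refl
    shift-V-odd (suc t) h odd = V-odd t h (≡.trans (≡.sym (parity-+-2 h t)) odd)

  -- Cut a path from height h+1 at its first visit to height h, which is an E step.
  V-first-passage : ∀ t h → V (suc h) t ≈ b * shift (V 0 ⋆ V h) t
  V-first-passage = <-rec _ step
    where
    step : ∀ t → (∀ {s} → s < t → ∀ h → V (suc h) s ≈ b * shift (V 0 ⋆ V h) s) →
           ∀ h → V (suc h) t ≈ b * shift (V 0 ⋆ V h) t
    step zero          _  h = trans (V-suc-zero h) (sym (zeroʳ b))
    step (suc zero)    _  h = begin
        V (suc h) 1
      ≈⟨ V-suc-suc h 0 ⟩
        V (suc (suc h)) 0 + (b * V h 0 + a * 0#)
      ≈⟨ trans (+-cong (V-suc-zero (suc h)) (+-congˡ (zeroʳ a))) (trans (+-identityˡ _) (+-identityʳ _)) ⟩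
        b * V h 0
      ≈⟨ *-congˡ (trans (sym (*-identityˡ _)) (*-congʳ (sym V-zero-zero))) ⟩
        b * (V 0 0 * V h 0) ∎
    step (suc (suc m)) ih h = begin
        V (suc h) (suc (suc m))
      ≈⟨ V-suc-suc h (suc m) ⟩
        V (suc (suc h)) (suc m) + (b * V h (suc m) + a * V (suc h) m)
      ≈⟨ +-cong (ih ≤-refl (suc h)) (+-congˡ (*-congˡ (ih (m≤n⇒m≤1+n ≤-refl) h))) ⟩
        b * (V 0 ⋆ V (suc h)) m + (b * V h (suc m) + a * (b * shift (V 0 ⋆ V h) m))
      ≈⟨ solve 5 (λ a b q z s → b :* q :+ (b :* z :+ a :* (b :* s)) := b :* (z :+ (q :+ a :* s)))
                 refl a b ((V 0 ⋆ V (suc h)) m) (V h (suc m)) (shift (V 0 ⋆ V h) m) ⟩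
        b * (V h (suc m) + ((V 0 ⋆ V (suc h)) m + a * shift (V 0 ⋆ V h) m))
      ≈⟨ *-congˡ (+-cong (trans (sym (*-identityˡ _)) (*-congʳ (sym V-zero-zero))) (sym tail-V₀)) ⟩
        b * (V 0 ⋆ V h) (suc m) ∎
      where
      earlier : ∀ h′ i → i ≤ m → V (suc h′) i ≈ b * shift (V 0 ⋆ V h′) i
      earlier h′ i i≤m = ih (m≤n⇒m<2+n i≤m) h′
      tail-V₀ : (tail (V 0) ⋆ V h) m ≈ (V 0 ⋆ V (suc h)) m + a * shift (V 0 ⋆ V h) m
      tail-V₀ = begin
        (tail (V 0) ⋆ V h) m                             ≈⟨ ⋆-cong m V-zero-suc (λ _ → refl) ⟩
        ((λ i → V 1 i + a * shift (V 0) i) ⋆ V h) m       ≈⟨ ⋆-distribʳ (V 1) (λ i → a * shift (V 0) i) (V h) m ⟩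
        (V 1 ⋆ V h) m + ((λ i → a * shift (V 0) i) ⋆ V h) m
          ≈⟨ +-cong (⋆-reassoc-≤ b (V 0) (V 0) (V h) m (earlier 0) (earlier h))
                    (trans (⋆-*ˡ a (shift (V 0)) (V h) m) (*-congˡ (⋆-shiftˡ (V 0) (V h) m))) ⟩
        (V 0 ⋆ V (suc h)) m + a * shift (V 0 ⋆ V h) m     ∎

  v : ℕ → Carrier
  v m = V 0 (m ℕ.+ m)

  v-suc : ∀ m → v (suc m) ≈ b * (v ⋆ v) m + a * v m
  v-suc m = begin
    V 0 (suc m ℕ.+ suc m)                                     ≡⟨ ≡.cong (V 0) (double-suc m) ⟩
    V 0 (suc (suc (m ℕ.+ m)))                                 ≈⟨ V-zero-suc (suc (m ℕ.+ m)) ⟩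
    V 1 (suc (m ℕ.+ m)) + a * V 0 (m ℕ.+ m)                   ≈⟨ +-congʳ (V-first-passage (suc (m ℕ.+ m)) 0) ⟩
    b * (V 0 ⋆ V 0) (m ℕ.+ m) + a * V 0 (m ℕ.+ m)             ≈⟨ +-congʳ (*-congˡ (⋆-even (V 0) (V 0) V₀-odd m)) ⟩
    b * (v ⋆ v) m + a * v m                                   ∎
    where
    V₀-odd : ∀ i → V 0 (suc (i ℕ.+ i)) ≈ 0#
    V₀-odd i = V-odd (suc (i ℕ.+ i)) 0 (parity-odd i)

  Sch-motzkin : ∀ M → IsMotzkin (a + b + b) (a * b + b * b) M → ∀ m → Sch a b (suc m) ≈ (a + b) * M m
  Sch-motzkin M M-motzkin m = trans (Sch≈V (suc m)) (schroder-motzkin a b v M M-motzkin V-zero-zero v-suc m)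

theorem1p3 : {c ℓ : Level} (R : CommutativeRing c ℓ) →
    let open CommutativeRing R
        open Weights R
    in (a b : Carrier) (n : ℕ) → 1 ≤ n →
       (Cat a b n ≈ a * Mot (a + b) (a * b) (n ∸ 1))
       × (b * Sch a b n ≈ (a + b) * Cat b (a + b) n)
       × (Sch a b n ≈ (a + b) * Mot (a + b + b) (a * b + b * b) (n ∸ 1))
theorem1p3 R a b (suc m) (s≤s z≤n) =
  CatalanCounts.Cat-motzkin R a b _ (Mot-motzkin (a + b) (a * b)) m ,
  Sch-as-Cat ,
  Sch-motzkin a b _ M-motzkin m
  where
  open CommutativeRing R
  open Weights R
  open Recurrences R using (IsMotzkin; IsMotzkin-cong)
  open MotzkinCounts R using (Mot-motzkin)
  open SchroderCounts R using (Sch-motzkin)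
  open import Relation.Binary.Reasoning.Setoid setoid
  open import Algebra.Properties.CommutativeSemigroup *-commutativeSemigroup using (x∙yz≈y∙xz)

  M : ℕ → Carrier
  M = Mot (a + b + b) (a * b + b * b)
  M-motzkin : IsMotzkin (a + b + b) (a * b + b * b) M
  M-motzkin = Mot-motzkin (a + b + b) (a * b + b * b)

  Sch-as-Cat : b * Sch a b (suc m) ≈ (a + b) * Cat b (a + b) (suc m)
  Sch-as-Cat = begin
    b * Sch a b (suc m)              ≈⟨ *-congˡ (Sch-motzkin a b M M-motzkin m) ⟩
    b * ((a + b) * M m)              ≈⟨ x∙yz≈y∙xz b (a + b) (M m) ⟩
    (a + b) * (b * M m)              ≈⟨ *-congˡ (CatalanCounts.Cat-motzkin R b (a + b) M M-motzkin′ m) ⟨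
    (a + b) * Cat b (a + b) (suc m)  ∎
    where
    M-motzkin′ : IsMotzkin (b + (a + b)) (b * (a + b)) M
    M-motzkin′ = IsMotzkin-cong (+-comm (a + b) b) (trans (+-congʳ (*-comm a b)) (sym (distribˡ b a b))) M-motzkin
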